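{- The inverse monoid $\mathrm{FPT}$ is residually finite: for all distinct $u,v\in\mathrm{FPT}$ there exist a finite monoid $N$ and a monoid homomorphism $\alpha:\mathrm{FPT}\to N$ with $\alpha(u)\neq\alpha(v)$.
   Context: A tree is a nonempty prefix-closed set $A\subseteq(\mathbb N^+)^*$ with $wj\in A$, $i<j$ implying $wi\in A$. A permutation tree is a map $t:A\to\mathrm{Sym}(\mathbb N^+)$ such that a node with exactly $n$ children has label in $S_n$ (permutations of $\mathbb N^+$ fixing all $i>n$). Write $t=\langle\pi;t_1,..,t_n\rangle$; $\bar\epsilon$ is the one-node tree. $\mathrm{FPT}$ is the set of finite permutation trees, with product: $t\bar\epsilon=t=\bar\epsilon t$; for $t=\langle\pi;t_1..t_n\rangle$, $u=\langle\rho;u_1..u_m\rangle$: if $n\ge m$, $tu=\langle\pi\circ\rho;u_1t_{\rho1},..,u_mt_{\rho m},t_{m+1},..,t_n\rangle$; if $m\ge n$, $tu=\langle\pi\circ\rho;u_1t_{\rho1},..,u_mt_{\rho m}\rangle$ with $t_j:=\bar\epsilon$ for $j>n$; and $\bar\epsilon^*=\bar\epsilon$, $t^*=\langle\pi^{ -1};(t_{\pi^{ -1}1})^*,..,(t_{\pi^{ -1}n})^*\rangle$. -}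

module Defs where

open import Level using (0ℓ)
open import Data.Nat using (ℕ; zero; suc; _+_; _∸_; _≤_; _<_; _<?_; _≤?_)
open import Data.Nat.Properties using (m+[n∸m]≡n; ≰⇒>; <⇒≤)
open import Data.Fin using (Fin; toℕ; fromℕ<)
open import Data.Fin.Properties using (+↔⊎)
open import Data.Fin.Permutation using (Permutation′; _⟨$⟩ʳ_; _∘ₚ_)
import Data.Fin.Permutation as P
open import Data.Sum.Function.Propositional using (_⊎-↔_)
open import Function.Properties.Inverse using (↔-trans; ↔-sym)
open import Relation.Nullary using (yes; no)
open import Relation.Binary.PropositionalEquality using (_≡_; subst)
open import Algebra.Bundles using (RawMonoid; Monoid)
open import Algebra.Morphism.Structures using (module MonoidMorphisms)
open import Data.Product using (Σ; ∃; _,_)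

-- Finite permutation trees: a node with n children (indexed by Fin n,
-- i.e. children 1..n of the paper are 0..n-1 here) labelled by a
-- permutation of Fin n (an element of S_n).
data FPT : Set where
  node : (n : ℕ) → Permutation′ n → (Fin n → FPT) → FPT

data _≈T_ : FPT → FPT → Set where
  node≈ : ∀ {n π ρ ts us} →
          (∀ i → π ⟨$⟩ʳ i ≡ ρ ⟨$⟩ʳ i) →
          (∀ i → ts i ≈T us i) →
          node n π ts ≈T node n ρ us

ε̄ : FPT
ε̄ = node 0 P.id (λ ())

-- a permutation of Fin n, extended to Fin k (k ≥ n) fixing all points ≥ n
liftPerm : ∀ {n k} → n ≤ k → Permutation′ n → Permutation′ k
liftPerm {n} {k} n≤k π =
  subst Permutation′ (m+[n∸m]≡n n≤k)
    (↔-trans +↔⊎ (↔-trans (π ⊎-↔ P.id) (↔-sym +↔⊎)))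

-- composition in the usual (right-to-left) order: (π ∘ᵖ ρ) x = π (ρ x)
_∘ᵖ_ : ∀ {k} → Permutation′ k → Permutation′ k → Permutation′ k
π ∘ᵖ ρ = ρ ∘ₚ π

-- The result has
-- k = max(n,m) children; child i (for i < m) is u_i t_{ρ i}, where
-- t_j := ε̄ for j ≥ n (and u ε̄ = u); child i for m ≤ i < n is t_i.
infixl 7 _·_
_·_ : FPT → FPT → FPT
t · node zero _ _ = t
node zero _ _ · u = u
node (suc n′) π ts · node (suc m′) ρ us with suc m′ ≤? suc n′
... | yes m≤n = node (suc n′) (π ∘ᵖ liftPerm m≤n ρ) (λ i → child i)
  where
  child : Fin (suc n′) → FPT
  child i with toℕ i <? suc m′
  ... | no _ = ts i
  ... | yes i<m with toℕ (ρ ⟨$⟩ʳ fromℕ< i<m) <? suc n′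
  ...   | yes j<n = us (fromℕ< i<m) · ts (fromℕ< j<n)
  ...   | no _ = us (fromℕ< i<m)
... | no m≰n = node (suc m′) (liftPerm (<⇒≤ (≰⇒> m≰n)) π ∘ᵖ ρ) (λ i → child i)
  where
  child : Fin (suc m′) → FPT
  child i with toℕ (ρ ⟨$⟩ʳ i) <? suc n′
  ... | yes j<n = us i · ts (fromℕ< j<n)
  ... | no _ = us i

FPT-rawMonoid : RawMonoid 0ℓ 0ℓ
FPT-rawMonoid = record { Carrier = FPT ; _≈_ = _≈T_ ; _∙_ = _·_ ; ε = ε̄ }

IsFiniteMonoid : Monoid 0ℓ 0ℓ → Set
IsFiniteMonoid N = Σ ℕ λ k → Σ (Fin k → Monoid.Carrier N) λ f →
                     ∀ x → ∃ λ i → Monoid._≈_ N (f i) x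

IsFPTMonoidHom : (N : Monoid 0ℓ 0ℓ) → (FPT → Monoid.Carrier N) → Set
IsFPTMonoidHom N α =
  MonoidMorphisms.IsMonoidHomomorphism FPT-rawMonoid (Monoid.rawMonoid N) α

-- FPT acts on words over ℕ × Bool. On a letter (i , b) a tree t applies its root label to i
-- and raises the flag b when i < arity t; the rest of the word is then acted on by the child
-- t_i, through the action of its inverse, because the product formula (tu)_i = u_i t_{ρ i}
-- composes children in the reverse order. This is a monoid action, and a tree whose first D
-- levels have arity at most K preserves the finite set of admissible words (length D, letters
-- below K). The trees violating the bound form an ideal, so sending a bounded tree to its
-- action on admissible words and every other tree to an adjoined zero is a homomorphism into
-- a finite monoid. Once K and D exceed the widths and heights of u ≉ v, the first place where
-- u and v differ (an arity, a root label, or recursively a subtree) yields an admissible word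
-- on which they act differently.

module Submission where

open import Defs
open import Level using (0ℓ)
open import Algebra.Bundles using (Monoid)
open import Data.Bool using (Bool; true; false; _∨_)
open import Data.Bool.Properties using (∨-assoc; ∨-identityʳ)
open import Data.Empty using (⊥)
open import Data.Empty.Irrelevant using (⊥-elim)
open import Data.Fin as Fin using (Fin; toℕ; fromℕ<; splitAt; _↑ˡ_; combine; remQuot; finToFun; funToFin)
open import Data.Fin.Patterns using (0F)
open import Data.Fin.Permutation using (Permutation′; _⟨$⟩ʳ_; flip; inverseˡ)
import Data.Fin.Permutation as P
open import Data.Fin.Properties using (+↔⊎)
import Data.Fin.Properties as Finₚ
open import Data.List using (List; []; _∷_; replicate)
open import Data.List.Properties using (∷-injectiveˡ; ∷-injectiveʳ)
open import Data.Maybe using (Maybe; just; nothing; zipWith)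
open import Data.Maybe.Relation.Binary.Pointwise using (Pointwise; just; nothing)
import Data.Maybe.Relation.Binary.Pointwise as Pointwise
open import Data.Nat using (ℕ; zero; suc; _+_; _*_; _^_; _⊔_; _≤_; _<_; _<?_; _≤?_; _≟_; z≤n; s≤s)
import Data.Nat.Properties as ℕ
open import Data.Product using (Σ; ∃; _×_; _,_; proj₁; proj₂; map; uncurry)
open import Data.Sum using (inj₁; inj₂)
open import Data.Sum.Function.Propositional using (_⊎-↔_)
open import Data.Unit using (⊤; tt)
open import Function using (_∘_; _∘′_; id; Inverse)
open import Function.Properties.Inverse using (↔-trans; ↔-sym)
open import Relation.Binary using (Decidable; IsEquivalence; tri<; tri≈; tri>)
open import Relation.Binary.PropositionalEquality
open import Relation.Nullary using (Dec; yes; no; ¬_; does; contradiction)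
open import Relation.Nullary.Decidable using (_×-dec_; dec-true; dec-false)
open ≡-Reasoning

-- Permutations of Fin n acting on ℕ

-- π ∈ S_n acts on ℕ fixing every i ≥ n, as S_n ⊆ Sym(ℕ⁺) in the paper (indices shifted to start at 0).
infixr 9 _⟨$⟩ℕ_

_⟨$⟩ℕ_ : ∀ {n} → Permutation′ n → ℕ → ℕ
_⟨$⟩ℕ_ {n} π i with i <? n
... | yes i<n = toℕ (π ⟨$⟩ʳ fromℕ< i<n)
... | no _ = i

private variable
  n : ℕ

⟨$⟩ℕ-toℕ : ∀ (π : Permutation′ n) j → π ⟨$⟩ℕ toℕ j ≡ toℕ (π ⟨$⟩ʳ j)
⟨$⟩ℕ-toℕ {n} π j with toℕ j <? n
... | yes j<n = cong (λ k → toℕ (π ⟨$⟩ʳ k)) (Finₚ.fromℕ<-toℕ j j<n)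
... | no j≮n = contradiction (Finₚ.toℕ<n j) j≮n

⟨$⟩ℕ-≥ : ∀ (π : Permutation′ n) {i} → n ≤ i → π ⟨$⟩ℕ i ≡ i
⟨$⟩ℕ-≥ {n} π {i} n≤i with i <? n
... | yes i<n = contradiction n≤i (ℕ.<⇒≱ i<n)
... | no _ = refl

flip-⟨$⟩ℕ : ∀ (π : Permutation′ n) i → flip π ⟨$⟩ℕ π ⟨$⟩ℕ i ≡ i
flip-⟨$⟩ℕ {n} π i with i <? n
... | yes i<n = trans (⟨$⟩ℕ-toℕ (flip π) _) (trans (cong toℕ (inverseˡ π)) (Finₚ.toℕ-fromℕ< i<n))
... | no i≮n = ⟨$⟩ℕ-≥ (flip π) (ℕ.≮⇒≥ i≮n)

⟨$⟩ℕ-flip : ∀ (π : Permutation′ n) i → π ⟨$⟩ℕ flip π ⟨$⟩ℕ i ≡ i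
⟨$⟩ℕ-flip π = flip-⟨$⟩ℕ (flip π)

flip-⟨$⟩ℕ-unique : ∀ (π : Permutation′ n) {f : ℕ → ℕ} → (∀ i → π ⟨$⟩ℕ f i ≡ i) →
                   ∀ i → flip π ⟨$⟩ℕ i ≡ f i
flip-⟨$⟩ℕ-unique π {f} πf≗id i = begin
  flip π ⟨$⟩ℕ i              ≡⟨ cong (flip π ⟨$⟩ℕ_) (πf≗id i) ⟨
  flip π ⟨$⟩ℕ π ⟨$⟩ℕ f i     ≡⟨ flip-⟨$⟩ℕ π (f i) ⟩
  f i                        ∎

⟨$⟩ℕ-∘ᵖ : ∀ (π ρ : Permutation′ n) i → (π ∘ᵖ ρ) ⟨$⟩ℕ i ≡ π ⟨$⟩ℕ ρ ⟨$⟩ℕ i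
⟨$⟩ℕ-∘ᵖ {n} π ρ i with i <? n
... | yes _ = sym (⟨$⟩ℕ-toℕ π _)
... | no i≮n = sym (⟨$⟩ℕ-≥ π (ℕ.≮⇒≥ i≮n))

toℕ-liftPerm : ∀ {k} (n≤k : n ≤ k) (π : Permutation′ n) j →
               toℕ (liftPerm n≤k π ⟨$⟩ʳ j) ≡ π ⟨$⟩ℕ toℕ j
toℕ-liftPerm {n} n≤k π = go (ℕ.m+[n∸m]≡n n≤k)
  where
  go : ∀ {d k} (e : n + d ≡ k) (j : Fin k) →
       toℕ (subst Permutation′ e (↔-trans +↔⊎ (↔-trans (π ⊎-↔ P.id) (↔-sym +↔⊎))) ⟨$⟩ʳ j) ≡ π ⟨$⟩ℕ toℕ j
  go {d} refl j with splitAt n j in eq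
  ... | inj₁ a rewrite sym (Finₚ.splitAt⁻¹-↑ˡ eq) = begin
    toℕ ((π ⟨$⟩ʳ a) ↑ˡ d)   ≡⟨ Finₚ.toℕ-↑ˡ _ d ⟩
    toℕ (π ⟨$⟩ʳ a)          ≡⟨ ⟨$⟩ℕ-toℕ π a ⟨
    π ⟨$⟩ℕ toℕ a            ≡⟨ cong (π ⟨$⟩ℕ_) (Finₚ.toℕ-↑ˡ a d) ⟨
    π ⟨$⟩ℕ toℕ (a ↑ˡ d)     ∎
  ... | inj₂ b rewrite sym (Finₚ.splitAt⁻¹-↑ʳ eq) =
    sym (⟨$⟩ℕ-≥ π (subst (n ≤_) (sym (Finₚ.toℕ-↑ʳ n b)) (ℕ.m≤m+n n _)))

⟨$⟩ℕ-liftPerm : ∀ {k} (n≤k : n ≤ k) (π : Permutation′ n) i → liftPerm n≤k π ⟨$⟩ℕ i ≡ π ⟨$⟩ℕ i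
⟨$⟩ℕ-liftPerm {k = k} n≤k π i with i <? k
... | yes i<k = trans (toℕ-liftPerm n≤k π _) (cong (π ⟨$⟩ℕ_) (Finₚ.toℕ-fromℕ< i<k))
... | no i≮k = sym (⟨$⟩ℕ-≥ π (ℕ.≤-trans n≤k (ℕ.≮⇒≥ i≮k)))

⟨$⟩ℕ-<-mono : ∀ (π : Permutation′ n) {K i} → n ≤ K → i < K → π ⟨$⟩ℕ i < K
⟨$⟩ℕ-<-mono {n} π {i = i} n≤K i<K with i <? n
... | yes _ = ℕ.<-≤-trans (Finₚ.toℕ<n _) n≤K
... | no _ = i<K

-- Arity, labels, children and the product formula

arity : FPT → ℕ
arity (node n _ _) = n

label : FPT → ℕ → ℕ
label (node _ π _) = π ⟨$⟩ℕ_

label⁻¹ : FPT → ℕ → ℕ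
label⁻¹ (node _ π _) = flip π ⟨$⟩ℕ_

-- The paper's convention t_j := ε̄ beyond the arity.
child : FPT → ℕ → FPT
child (node n _ ts) i with i <? n
... | yes i<n = ts (fromℕ< i<n)
... | no _ = ε̄

label-≥ : ∀ t {i} → arity t ≤ i → label t i ≡ i
label-≥ (node _ π _) = ⟨$⟩ℕ-≥ π

label⁻¹-≥ : ∀ t {i} → arity t ≤ i → label⁻¹ t i ≡ i
label⁻¹-≥ (node _ π _) = ⟨$⟩ℕ-≥ (flip π)

label⁻¹-label : ∀ t i → label⁻¹ t (label t i) ≡ i
label⁻¹-label (node _ π _) = flip-⟨$⟩ℕ π

label-label⁻¹ : ∀ t i → label t (label⁻¹ t i) ≡ i
label-label⁻¹ (node _ π _) = ⟨$⟩ℕ-flip π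

label⁻¹-unique : ∀ t {f : ℕ → ℕ} → (∀ i → label t (f i) ≡ i) → ∀ i → label⁻¹ t i ≡ f i
label⁻¹-unique (node _ π _) = flip-⟨$⟩ℕ-unique π

label-<-mono : ∀ t {K i} → arity t ≤ K → i < K → label t i < K
label-<-mono (node _ π _) = ⟨$⟩ℕ-<-mono π

label⁻¹-<-mono : ∀ t {K i} → arity t ≤ K → i < K → label⁻¹ t i < K
label⁻¹-<-mono (node _ π _) = ⟨$⟩ℕ-<-mono (flip π)

child-< : ∀ {n π ts i} (i<n : i < n) → child (node n π ts) i ≡ ts (fromℕ< i<n)
child-< {n} {i = i} i<n with i <? n
... | yes _ = refl
... | no i≮n = contradiction i<n i≮n

child-≥ : ∀ t {i} → arity t ≤ i → child t i ≡ ε̄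
child-≥ (node n _ _) {i} n≤i with i <? n
... | yes i<n = contradiction n≤i (ℕ.<⇒≱ i<n)
... | no _ = refl

child-toℕ : ∀ {n π ts} (j : Fin n) → child (node n π ts) (toℕ j) ≡ ts j
child-toℕ {π = π} {ts} j =
  trans (child-< {π = π} (Finₚ.toℕ<n j)) (cong ts (Finₚ.fromℕ<-toℕ j (Finₚ.toℕ<n j)))

≈T-refl : ∀ {t} → t ≈T t
≈T-refl {node n π ts} = node≈ (λ _ → refl) (λ _ → ≈T-refl)

≈T-sym : ∀ {t u} → t ≈T u → u ≈T t
≈T-sym (node≈ eπ ets) = node≈ (λ i → sym (eπ i)) (λ i → ≈T-sym (ets i))

arity-cong : ∀ {t u} → t ≈T u → arity t ≡ arity u
arity-cong (node≈ _ _) = refl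

label-cong : ∀ {t u} → t ≈T u → ∀ i → label t i ≡ label u i
label-cong (node≈ {n} eπ _) i with i <? n
... | yes i<n = cong toℕ (eπ (fromℕ< i<n))
... | no _ = refl

label⁻¹-cong : ∀ {t u} → t ≈T u → ∀ i → label⁻¹ t i ≡ label⁻¹ u i
label⁻¹-cong {t} {u} t≈u = label⁻¹-unique t λ i →
  trans (label-cong t≈u (label⁻¹ u i)) (label-label⁻¹ u i)

child-cong : ∀ {t u} → t ≈T u → ∀ i → child t i ≈T child u i
child-cong (node≈ {n} _ ets) i with i <? n
... | yes i<n = ets (fromℕ< i<n)
... | no _ = ≈T-refl

·-identityˡ : ∀ t → (ε̄ · t) ≈T t
·-identityˡ (node zero _ _) = node≈ (λ ()) (λ ())
·-identityˡ (node (suc _) _ _) = ≈T-refl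

module _ {n′ m′ : ℕ} {π : Permutation′ (suc n′)} {ts : Fin (suc n′) → FPT}
         {ρ : Permutation′ (suc m′)} {us : Fin (suc m′) → FPT} where

  private
    t : FPT
    t = node (suc n′) π ts
    u : FPT
    u = node (suc m′) ρ us

  -- Stated at toℕ j: once fromℕ< (toℕ j) is rewritten to j, the with-scrutinees of the
  -- clauses of _·_ are those of child and label on the right, so every case computes.
  child-·-toℕ : ∀ (j : Fin (arity (t · u))) →
                child (t · u) (toℕ j) ≈T (child u (toℕ j) · child t (label u (toℕ j)))
  child-·-toℕ j with suc m′ ≤? suc n′
  ... | yes m≤n with toℕ j <? suc n′
  ...   | no j≮n = contradiction (Finₚ.toℕ<n j) j≮n
  ...   | yes j<n rewrite Finₚ.fromℕ<-toℕ j j<n with toℕ j <? suc m′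
  ...     | yes j<m with toℕ (ρ ⟨$⟩ʳ fromℕ< j<m) <? suc n′
  ...       | yes _ = ≈T-refl
  ...       | no ρj≮n = contradiction (ℕ.≤-trans (Finₚ.toℕ<n _) m≤n) ρj≮n
  child-·-toℕ j | yes m≤n | yes j<n | no _ rewrite child-toℕ {π = π} {ts} j =
    ≈T-sym (·-identityˡ (ts j))
  child-·-toℕ j | no m≰n with toℕ j <? suc m′
  ... | no j≮m = contradiction (Finₚ.toℕ<n j) j≮m
  ... | yes j<m rewrite Finₚ.fromℕ<-toℕ j j<m with toℕ (ρ ⟨$⟩ʳ j) <? suc n′
  ...   | yes _ = ≈T-refl
  ...   | no _ = ≈T-refl

arity-· : ∀ t u → arity (t · u) ≡ arity t ⊔ arity u
arity-· t (node zero _ _) = sym (ℕ.⊔-identityʳ (arity t))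
arity-· (node zero _ _) (node (suc _) _ _) = refl
arity-· (node (suc n′) _ _) (node (suc m′) _ _) with suc m′ ≤? suc n′
... | yes m≤n = sym (ℕ.m≥n⇒m⊔n≡m m≤n)
... | no m≰n = sym (ℕ.m≤n⇒m⊔n≡n (ℕ.<⇒≤ (ℕ.≰⇒> m≰n)))

label-· : ∀ t u i → label (t · u) i ≡ label t (label u i)
label-· t u@(node zero _ _) i = cong (label t) (sym (label-≥ u z≤n))
label-· t@(node zero _ _) (node (suc _) _ _) i = sym (label-≥ t z≤n)
label-· (node (suc n′) π _) (node (suc m′) ρ _) i with suc m′ ≤? suc n′
... | yes m≤n = trans (⟨$⟩ℕ-∘ᵖ π _ i) (cong (π ⟨$⟩ℕ_) (⟨$⟩ℕ-liftPerm m≤n ρ i))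
... | no m≰n = trans (⟨$⟩ℕ-∘ᵖ (liftPerm n≤m π) ρ i) (⟨$⟩ℕ-liftPerm n≤m π (ρ ⟨$⟩ℕ i))
  where n≤m = ℕ.<⇒≤ (ℕ.≰⇒> m≰n)

label⁻¹-· : ∀ t u i → label⁻¹ (t · u) i ≡ label⁻¹ u (label⁻¹ t i)
label⁻¹-· t u = label⁻¹-unique (t · u) λ i → begin
  label (t · u) (label⁻¹ u (label⁻¹ t i))       ≡⟨ label-· t u _ ⟩
  label t (label u (label⁻¹ u (label⁻¹ t i)))   ≡⟨ cong (label t) (label-label⁻¹ u _) ⟩
  label t (label⁻¹ t i)                         ≡⟨ label-label⁻¹ t i ⟩
  i                                             ∎

child-·-≥ : ∀ t u {i} → arity t ⊔ arity u ≤ i → child (t · u) i ≈T (child u i · child t (label u i))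
child-·-≥ t u {i} t⊔u≤i
  rewrite child-≥ (t · u) (subst (_≤ i) (sym (arity-· t u)) t⊔u≤i)
        | child-≥ u (ℕ.≤-trans (ℕ.m≤n⊔m (arity t) _) t⊔u≤i)
        | label-≥ u (ℕ.≤-trans (ℕ.m≤n⊔m (arity t) _) t⊔u≤i)
        | child-≥ t (ℕ.≤-trans (ℕ.m≤m⊔n _ (arity u)) t⊔u≤i) = ≈T-refl

child-· : ∀ t u i → child (t · u) i ≈T (child u i · child t (label u i))
child-· t u@(node zero _ _) i rewrite child-≥ u {i} z≤n | label-≥ u {i} z≤n =
  ≈T-sym (·-identityˡ (child t i))
child-· t@(node zero _ _) u@(node (suc _) _ _) i rewrite child-≥ t {label u i} z≤n = ≈T-refl
child-· t@(node (suc _) _ _) u@(node (suc _) _ _) i with i <? arity (t · u)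
... | yes i<k = subst (λ i → child (t · u) i ≈T (child u i · child t (label u i)))
                      (Finₚ.toℕ-fromℕ< i<k) (child-·-toℕ (fromℕ< i<k))
... | no i≮k = child-·-≥ t u (subst (_≤ i) (arity-· t u) (ℕ.≮⇒≥ i≮k))

-- The action on words

<?-⊔-along : ∀ {m} n (f : ℕ → ℕ) → (∀ {i} → i < m → f i < m) → (∀ {i} → m ≤ i → f i ≡ i) →
             ∀ i → does (i <? m) ∨ does (f i <? n) ≡ does (i <? n ⊔ m)
<?-⊔-along {m} n f f-< f-≥ i with i <? m | i <? n
... | yes i<m | _ = begin
  does (i <? m) ∨ does (f i <? n)   ≡⟨ cong (_∨ does (f i <? n)) (dec-true (i <? m) i<m) ⟩
  true                              ≡⟨ dec-true (i <? n ⊔ m) (ℕ.<-≤-trans i<m (ℕ.m≤n⊔m n m)) ⟨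
  does (i <? n ⊔ m)                 ∎
... | no i≮m | yes i<n = begin
  does (i <? m) ∨ does (f i <? n)   ≡⟨ cong (_∨ does (f i <? n)) (dec-false (i <? m) i≮m) ⟩
  does (f i <? n)      ≡⟨ cong (λ k → does (k <? n)) (f-≥ (ℕ.≮⇒≥ i≮m)) ⟩
  does (i <? n)        ≡⟨ dec-true (i <? n) i<n ⟩
  true                 ≡⟨ dec-true (i <? n ⊔ m) (ℕ.<-≤-trans i<n (ℕ.m≤m⊔n n m)) ⟨
  does (i <? n ⊔ m)    ∎
... | no i≮m | no i≮n = begin
  does (i <? m) ∨ does (f i <? n)   ≡⟨ cong (_∨ does (f i <? n)) (dec-false (i <? m) i≮m) ⟩
  does (f i <? n)      ≡⟨ cong (λ k → does (k <? n)) (f-≥ (ℕ.≮⇒≥ i≮m)) ⟩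
  does (i <? n)        ≡⟨ dec-false (i <? n) i≮n ⟩
  false                ≡⟨ dec-false (i <? n ⊔ m) (ℕ.≤⇒≯ (ℕ.⊔-lub (ℕ.≮⇒≥ i≮n) (ℕ.≮⇒≥ i≮m))) ⟨
  does (i <? n ⊔ m)    ∎

inside : FPT → ℕ → Bool
inside t i = does (i <? arity t)

inside-· : ∀ t u i → inside (t · u) i ≡ inside u i ∨ inside t (label u i)
inside-· t u i rewrite arity-· t u =
  sym (<?-⊔-along (arity t) (label u) (label-<-mono u ℕ.≤-refl) (label-≥ u) i)

inside-·⁻¹ : ∀ t u i → inside (t · u) i ≡ inside t i ∨ inside u (label⁻¹ t i)
inside-·⁻¹ t u i rewrite arity-· t u | ℕ.⊔-comm (arity t) (arity u) =
  sym (<?-⊔-along (arity u) (label⁻¹ t) (label⁻¹-<-mono t ℕ.≤-refl) (label⁻¹-≥ t) i)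

Word : Set
Word = List (ℕ × Bool)

-- act⁻¹ t is the action of the paper's t*.
mutual
  act : FPT → Word → Word
  act t [] = []
  act t ((i , b) ∷ w) = (label t i , b ∨ inside t i) ∷ act⁻¹ (child t i) w

  act⁻¹ : FPT → Word → Word
  act⁻¹ t [] = []
  act⁻¹ t ((i , b) ∷ w) = (label⁻¹ t i , b ∨ inside t i) ∷ act (child t (label⁻¹ t i)) w

mutual
  act-cong : ∀ {t u} → t ≈T u → ∀ w → act t w ≡ act u w
  act-cong t≈u [] = refl
  act-cong t≈u ((i , b) ∷ w) =
    cong₂ _∷_ (cong₂ _,_ (label-cong t≈u i) (cong (λ n → b ∨ does (i <? n)) (arity-cong t≈u)))
              (act⁻¹-cong (child-cong t≈u i) w)

  act⁻¹-cong : ∀ {t u} → t ≈T u → ∀ w → act⁻¹ t w ≡ act⁻¹ u w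
  act⁻¹-cong t≈u [] = refl
  act⁻¹-cong {t} {u} t≈u ((i , b) ∷ w) =
    cong₂ _∷_ (cong₂ _,_ (label⁻¹-cong t≈u i) (cong (λ n → b ∨ does (i <? n)) (arity-cong t≈u)))
              (trans (cong (λ j → act (child t j) w) (label⁻¹-cong t≈u i))
                     (act-cong (child-cong t≈u (label⁻¹ u i)) w))

mutual
  act-ε̄ : ∀ w → act ε̄ w ≡ w
  act-ε̄ [] = refl
  act-ε̄ ((i , b) ∷ w) rewrite label-≥ ε̄ {i} z≤n | child-≥ ε̄ {i} z≤n | ∨-identityʳ b =
    cong ((i , b) ∷_) (act⁻¹-ε̄ w)

  act⁻¹-ε̄ : ∀ w → act⁻¹ ε̄ w ≡ w
  act⁻¹-ε̄ [] = refl
  act⁻¹-ε̄ ((i , b) ∷ w) rewrite label⁻¹-≥ ε̄ {i} z≤n | child-≥ ε̄ {i} z≤n | ∨-identityʳ b =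
    cong ((i , b) ∷_) (act-ε̄ w)

mutual
  act-· : ∀ t u w → act (t · u) w ≡ act t (act u w)
  act-· t u [] = refl
  act-· t u ((i , b) ∷ w) = cong₂ _∷_ (cong₂ _,_ (label-· t u i) flag) (begin
    act⁻¹ (child (t · u) i) w                                ≡⟨ act⁻¹-cong (child-· t u i) w ⟩
    act⁻¹ (child u i · child t (label u i)) w                 ≡⟨ act⁻¹-· (child u i) _ w ⟩
    act⁻¹ (child t (label u i)) (act⁻¹ (child u i) w)         ∎)
    where
    flag : b ∨ inside (t · u) i ≡ (b ∨ inside u i) ∨ inside t (label u i)
    flag = trans (cong (b ∨_) (inside-· t u i)) (sym (∨-assoc b _ _))

  act⁻¹-· : ∀ t u w → act⁻¹ (t · u) w ≡ act⁻¹ u (act⁻¹ t w)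
  act⁻¹-· t u [] = refl
  act⁻¹-· t u ((i , b) ∷ w) = cong₂ _∷_ (cong₂ _,_ (label⁻¹-· t u i) flag) (begin
    act (child (t · u) (label⁻¹ (t · u) i)) w                 ≡⟨ cong (λ k → act (child (t · u) k) w) (label⁻¹-· t u i) ⟩
    act (child (t · u) j) w                                   ≡⟨ act-cong (child-· t u j) w ⟩
    act (child u j · child t (label u j)) w                   ≡⟨ act-· (child u j) _ w ⟩
    act (child u j) (act (child t (label u j)) w)             ≡⟨ cong (λ k → act (child u j) (act (child t k) w)) (label-label⁻¹ u _) ⟩
    act (child u j) (act (child t (label⁻¹ t i)) w)           ∎)
    where
    j : ℕ
    j = label⁻¹ u (label⁻¹ t i)
    flag : b ∨ inside (t · u) i ≡ (b ∨ inside t i) ∨ inside u (label⁻¹ t i)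
    flag = trans (cong (b ∨_) (inside-·⁻¹ t u i)) (sym (∨-assoc b _ _))

-- Bounded trees, admissible words and a finite quotient

Bounded : ℕ → ℕ → FPT → Set
Bounded K zero t = ⊤
Bounded K (suc D) (node n _ ts) = n ≤ K × ∀ j → Bounded K D (ts j)

bounded? : ∀ K D t → Dec (Bounded K D t)
bounded? K zero t = yes tt
bounded? K (suc D) (node n _ ts) = (n ≤? K) ×-dec Finₚ.all? (λ j → bounded? K D (ts j))

Bounded-ε̄ : ∀ K D → Bounded K D ε̄
Bounded-ε̄ K zero = tt
Bounded-ε̄ K (suc D) = z≤n , λ ()

Bounded-child : ∀ {K D} t → Bounded K (suc D) t → ∀ i → Bounded K D (child t i)
Bounded-child {K} {D} (node n _ ts) (_ , bts) i with i <? n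
... | yes i<n = bts (fromℕ< i<n)
... | no _ = Bounded-ε̄ K D

Bounded⇒arity≤ : ∀ {K D} t → Bounded K (suc D) t → arity t ≤ K
Bounded⇒arity≤ (node _ _ _) = proj₁

Bounded-intro : ∀ {K D} t → arity t ≤ K → (∀ i → Bounded K D (child t i)) → Bounded K (suc D) t
Bounded-intro {K} {D} (node n π ts) n≤K bcs =
  n≤K , λ j → subst (Bounded K D) (child-toℕ {π = π} j) (bcs (toℕ j))

Bounded-cong : ∀ {K D t u} → t ≈T u → Bounded K D t → Bounded K D u
Bounded-cong {D = zero} _ _ = tt
Bounded-cong {D = suc D} (node≈ _ ets) (n≤K , bts) = n≤K , λ j → Bounded-cong (ets j) (bts j)

Bounded-· : ∀ {K D} t u → Bounded K D t → Bounded K D u → Bounded K D (t · u)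
Bounded-· {D = zero} t u _ _ = tt
Bounded-· {K} {suc D} t u bt bu = Bounded-intro (t · u)
  (subst (_≤ K) (sym (arity-· t u)) (ℕ.⊔-lub (Bounded⇒arity≤ t bt) (Bounded⇒arity≤ u bu)))
  λ i → Bounded-cong (≈T-sym (child-· t u i))
          (Bounded-· (child u i) _ (Bounded-child u bu i) (Bounded-child t bt _))

Bounded-·⁻ : ∀ {K D} t u → Bounded K D (t · u) → Bounded K D t × Bounded K D u
Bounded-·⁻ {D = zero} t u _ = tt , tt
Bounded-·⁻ {K} {suc D} t u btu = Bounded-intro t (ℕ.≤-trans (ℕ.m≤m⊔n _ _) tu≤K) bct ,
                                 Bounded-intro u (ℕ.≤-trans (ℕ.m≤n⊔m _ _) tu≤K) bcu
  where
  tu≤K : arity t ⊔ arity u ≤ K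
  tu≤K = subst (_≤ K) (arity-· t u) (Bounded⇒arity≤ (t · u) btu)
  bcs : ∀ i → Bounded K D (child u i) × Bounded K D (child t (label u i))
  bcs i = Bounded-·⁻ (child u i) _ (Bounded-cong (child-· t u i) (Bounded-child (t · u) btu i))
  bcu : ∀ i → Bounded K D (child u i)
  bcu i = proj₁ (bcs i)
  bct : ∀ i → Bounded K D (child t i)
  bct i = subst (λ k → Bounded K D (child t k)) (label-label⁻¹ u i) (proj₂ (bcs (label⁻¹ u i)))

Admissible : ℕ → ℕ → Word → Set
Admissible K zero [] = ⊤
Admissible K zero (_ ∷ _) = ⊥
Admissible K (suc D) [] = ⊥
Admissible K (suc D) ((i , _) ∷ w) = i < K × Admissible K D w

mutual
  act-admissible : ∀ {K D t w} → Bounded K D t → Admissible K D w → Admissible K D (act t w)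
  act-admissible {D = zero} {w = []} _ _ = tt
  act-admissible {D = suc D} {t} {(i , _) ∷ _} bt (i<K , aw) =
    label-<-mono t (Bounded⇒arity≤ t bt) i<K , act⁻¹-admissible (Bounded-child t bt i) aw

  act⁻¹-admissible : ∀ {K D t w} → Bounded K D t → Admissible K D w → Admissible K D (act⁻¹ t w)
  act⁻¹-admissible {D = zero} {w = []} _ _ = tt
  act⁻¹-admissible {D = suc D} {t} {(i , _) ∷ _} bt (i<K , aw) =
    label⁻¹-<-mono t (Bounded⇒arity≤ t bt) i<K , act-admissible (Bounded-child t bt _) aw

module _ {K : ℕ} where

  letter : Fin (K * 2) → ℕ × Bool
  letter l = map toℕ (Inverse.to Finₚ.2↔Bool) (remQuot {K} 2 l)

  letterCode : ∀ {i} → .(i < K) → Bool → Fin (K * 2)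
  letterCode i<K b = combine (fromℕ< i<K) (Inverse.from Finₚ.2↔Bool b)

  letter-letterCode : ∀ {i} .(i<K : i < K) b → letter (letterCode i<K b) ≡ (i , b)
  letter-letterCode {i} i<K b = begin
    map toℕ (Inverse.to Finₚ.2↔Bool) (remQuot {K} 2 (letterCode i<K b))
      ≡⟨ cong (map toℕ (Inverse.to Finₚ.2↔Bool)) (Finₚ.remQuot-combine {K} {2} (fromℕ< i<K) _) ⟩
    (toℕ (fromℕ< i<K) , Inverse.to Finₚ.2↔Bool (Inverse.from Finₚ.2↔Bool b))
      ≡⟨ cong₂ _,_ (Finₚ.toℕ-fromℕ< i<K) (Inverse.strictlyInverseˡ Finₚ.2↔Bool b) ⟩
    (i , b) ∎

  letterCode-letter : ∀ l .(i<K : proj₁ (letter l) < K) → letterCode i<K (proj₂ (letter l)) ≡ l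
  letterCode-letter l i<K = begin
    combine (fromℕ< i<K) (Inverse.from Finₚ.2↔Bool (Inverse.to Finₚ.2↔Bool (proj₂ (remQuot {K} 2 l))))
      ≡⟨ cong₂ combine (Finₚ.fromℕ<-toℕ _ i<K) (Inverse.strictlyInverseʳ Finₚ.2↔Bool _) ⟩
    uncurry combine (remQuot {K} 2 l)
      ≡⟨ Finₚ.combine-remQuot {K} 2 l ⟩
    l ∎

  decode : ∀ D → Fin ((K * 2) ^ D) → Word
  decode zero _ = []
  decode (suc D) x = uncurry (λ l r → letter l ∷ decode D r) (remQuot {K * 2} ((K * 2) ^ D) x)

  encode : ∀ D w → .(Admissible K D w) → Fin ((K * 2) ^ D)
  encode zero [] _ = 0F
  encode zero (_ ∷ _) a = ⊥-elim a
  encode (suc D) [] a = ⊥-elim a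
  encode (suc D) ((i , b) ∷ w) a = combine {K * 2} (letterCode (proj₁ a) b) (encode D w (proj₂ a))

  encode-cong : ∀ D {w w′} → w ≡ w′ → .(a : Admissible K D w) .(a′ : Admissible K D w′) →
                encode D w a ≡ encode D w′ a′
  encode-cong D refl _ _ = refl

  decode-admissible : ∀ D x → Admissible K D (decode D x)
  decode-admissible zero _ = tt
  decode-admissible (suc D) _ = Finₚ.toℕ<n _ , decode-admissible D _

  decode-encode : ∀ D w .(a : Admissible K D w) → decode D (encode D w a) ≡ w
  decode-encode zero [] _ = refl
  decode-encode (suc D) ((i , b) ∷ w) a = begin
    decode (suc D) (combine (letterCode (proj₁ a) b) (encode D w (proj₂ a)))
      ≡⟨ cong (uncurry (λ l r → letter l ∷ decode D r)) (Finₚ.remQuot-combine {K * 2} {(K * 2) ^ D} _ _) ⟩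
    letter (letterCode (proj₁ a) b) ∷ decode D (encode D w (proj₂ a))
      ≡⟨ cong₂ _∷_ (letter-letterCode (proj₁ a) b) (decode-encode D w (proj₂ a)) ⟩
    (i , b) ∷ w ∎

  encode-decode : ∀ D x .(a : Admissible K D (decode D x)) → encode D (decode D x) a ≡ x
  encode-decode zero 0F _ = refl
  encode-decode (suc D) x a = begin
    combine (letterCode (proj₁ a) (proj₂ (letter l))) (encode D (decode D r) (proj₂ a))
      ≡⟨ cong₂ combine (letterCode-letter l (proj₁ a)) (encode-decode D r (proj₂ a)) ⟩
    uncurry combine (remQuot {K * 2} ((K * 2) ^ D) x)
      ≡⟨ Finₚ.combine-remQuot {K * 2} ((K * 2) ^ D) x ⟩
    x ∎
    where
    l = proj₁ (remQuot {K * 2} ((K * 2) ^ D) x)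
    r = proj₂ (remQuot {K * 2} ((K * 2) ^ D) x)

transformations⁰ : ℕ → Monoid 0ℓ 0ℓ
transformations⁰ M = record
  { Carrier = Maybe (Fin M → Fin M)
  ; _≈_ = Pointwise _≗_
  ; _∙_ = zipWith _∘′_
  ; ε = just id
  ; isMonoid = record
    { isSemigroup = record
      { isMagma = record
        { isEquivalence = Pointwise.isEquivalence ≗-isEquivalence
        ; ∙-cong = ∙-cong }
      ; assoc = assoc }
    ; identity = identityˡ , identityʳ } }
  where
  ≗-isEquivalence : IsEquivalence (_≗_ {A = Fin M} {B = Fin M})
  ≗-isEquivalence = record
    { refl = λ _ → refl ; sym = λ f≗g x → sym (f≗g x) ; trans = λ f≗g g≗h x → trans (f≗g x) (g≗h x) }
  ∙-cong : ∀ {f g h k} → Pointwise _≗_ f g → Pointwise _≗_ h k →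
           Pointwise _≗_ (zipWith _∘′_ f h) (zipWith _∘′_ g k)
  ∙-cong nothing _ = nothing
  ∙-cong (just _) nothing = nothing
  ∙-cong {just f} {just g} {just h} (just f≗g) (just h≗k) =
    just λ x → trans (f≗g (h x)) (cong g (h≗k x))
  assoc : ∀ f g h → Pointwise _≗_ (zipWith _∘′_ (zipWith _∘′_ f g) h) (zipWith _∘′_ f (zipWith _∘′_ g h))
  assoc nothing _ _ = nothing
  assoc (just _) nothing _ = nothing
  assoc (just _) (just _) nothing = nothing
  assoc (just _) (just _) (just _) = just λ _ → refl
  identityˡ : ∀ f → Pointwise _≗_ (zipWith _∘′_ (just id) f) f
  identityˡ nothing = nothing
  identityˡ (just _) = just λ _ → refl
  identityʳ : ∀ f → Pointwise _≗_ (zipWith _∘′_ f (just id)) f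
  identityʳ nothing = nothing
  identityʳ (just _) = just λ _ → refl

transformations⁰-finite : ∀ M → IsFiniteMonoid (transformations⁰ M)
transformations⁰-finite M = suc (M ^ M) , enumerate , complete
  where
  enumerate : Fin (suc (M ^ M)) → Maybe (Fin M → Fin M)
  enumerate 0F = nothing
  enumerate (Fin.suc k) = just (finToFun k)
  complete : ∀ f → ∃ λ k → Pointwise _≗_ (enumerate k) f
  complete nothing = 0F , nothing
  complete (just f) = Fin.suc (funToFin f) , just (Finₚ.finToFun-funToFin f)

module Representation (K D : ℕ) where

  M : ℕ
  M = (K * 2) ^ D

  -- Unbounded trees form an ideal (Bounded-·⁻), so sending them all to the zero is multiplicative.
  represent : FPT → Maybe (Fin M → Fin M)
  represent t with bounded? K D t
  ... | yes bt = just λ x → encode D (act t (decode D x)) (act-admissible bt (decode-admissible D x))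
  ... | no _ = nothing

  represent-cong : ∀ {t u} → t ≈T u → Pointwise _≗_ (represent t) (represent u)
  represent-cong {t} {u} t≈u with bounded? K D t | bounded? K D u
  ... | yes _ | yes _ = just λ x → encode-cong D (act-cong t≈u (decode D x)) _ _
  ... | yes bt | no ¬bu = contradiction (Bounded-cong t≈u bt) ¬bu
  ... | no ¬bt | yes bu = contradiction (Bounded-cong (≈T-sym t≈u) bu) ¬bt
  ... | no _ | no _ = nothing

  represent-· : ∀ t u → Pointwise _≗_ (represent (t · u)) (zipWith _∘′_ (represent t) (represent u))
  represent-· t u with bounded? K D (t · u) | bounded? K D t | bounded? K D u
  ... | yes _ | yes _ | yes bu = just λ x → encode-cong D (begin
        act (t · u) (decode D x)                       ≡⟨ act-· t u (decode D x) ⟩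
        act t (act u (decode D x))                     ≡⟨ cong (act t) (decode-encode D _ _) ⟨
        act t (decode D (encode D (act u (decode D x)) (act-admissible bu (decode-admissible D x)))) ∎) _ _
  ... | yes btu | no ¬bt | _ = contradiction (proj₁ (Bounded-·⁻ t u btu)) ¬bt
  ... | yes btu | yes _ | no ¬bu = contradiction (proj₂ (Bounded-·⁻ t u btu)) ¬bu
  ... | no ¬btu | yes bt | yes bu = contradiction (Bounded-· t u bt bu) ¬btu
  ... | no _ | no _ | _ = nothing
  ... | no _ | yes _ | no _ = nothing

  represent-ε̄ : Pointwise _≗_ (represent ε̄) (just id)
  represent-ε̄ with bounded? K D ε̄
  ... | yes _ = just λ x →
    trans (encode-cong D (act-ε̄ (decode D x)) _ _) (encode-decode D x (decode-admissible D x))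
  ... | no ¬bε̄ = contradiction (Bounded-ε̄ K D) ¬bε̄

  represent-isHom : IsFPTMonoidHom (transformations⁰ M) represent
  represent-isHom = record
    { isMagmaHomomorphism = record
      { isRelHomomorphism = record { cong = represent-cong }
      ; homo = represent-· }
    ; ε-homo = represent-ε̄ }

  represent-≈⇒act-≡ : ∀ {u v} → Bounded K D u → Bounded K D v →
                      Pointwise _≗_ (represent u) (represent v) →
                      ∀ w → Admissible K D w → act u w ≡ act v w
  represent-≈⇒act-≡ {u} {v} bu bv ρu≈ρv w aw with bounded? K D u | bounded? K D v | ρu≈ρv
  ... | yes bu′ | yes bv′ | just ρu≗ρv = begin
    act u w                  ≡⟨ cong (act u) (decode-encode D w aw) ⟨
    act u (decode D x)       ≡⟨ decode-encode D _ (act-admissible bu′ (decode-admissible D x)) ⟨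
    decode D (ρu x)          ≡⟨ cong (decode D) (ρu≗ρv x) ⟩
    decode D (ρv x)          ≡⟨ decode-encode D _ (act-admissible bv′ (decode-admissible D x)) ⟩
    act v (decode D x)       ≡⟨ cong (act v) (decode-encode D w aw) ⟩
    act v w                  ∎
    where
    x = encode D w aw
    ρu ρv : Fin M → Fin M
    ρu y = encode D (act u (decode D y)) (act-admissible bu′ (decode-admissible D y))
    ρv y = encode D (act v (decode D y)) (act-admissible bv′ (decode-admissible D y))
  ... | no ¬bu | _ | _ = contradiction bu ¬bu
  ... | yes _ | no ¬bv | _ = contradiction bv ¬bv

-- Separating distinct trees

_≈T?_ : Decidable _≈T_
node n π ts ≈T? node m ρ us with n ≟ m
... | no n≢m = no λ { (node≈ _ _) → n≢m refl }
... | yes refl with Finₚ.all? (λ i → π ⟨$⟩ʳ i Finₚ.≟ ρ ⟨$⟩ʳ i) | Finₚ.all? (λ i → ts i ≈T? us i)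
...   | yes π≗ρ | yes ts≈us = yes (node≈ π≗ρ ts≈us)
...   | no π≉ρ | _ = no λ { (node≈ π≗ρ _) → π≉ρ π≗ρ }
...   | yes _ | no ts≉us = no λ { (node≈ _ ts≈us) → ts≉us ts≈us }

Fits : ℕ → ℕ → FPT → Set
Fits K zero t = ⊥
Fits K (suc D) (node n _ ts) = n ≤ K × ∀ j → Fits K D (ts j)

Fits⇒Bounded : ∀ {K D} t → Fits K D t → Bounded K D t
Fits⇒Bounded {D = suc D} (node _ _ ts) (n≤K , fts) = n≤K , λ j → Fits⇒Bounded (ts j) (fts j)

Fits-mono : ∀ {K K′ D D′} t → K ≤ K′ → D ≤ D′ → Fits K D t → Fits K′ D′ t
Fits-mono {D = suc D} {suc D′} (node _ _ ts) K≤K′ (s≤s D≤D′) (n≤K , fts) =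
  ℕ.≤-trans n≤K K≤K′ , λ j → Fits-mono (ts j) K≤K′ D≤D′ (fts j)

⨆ : ∀ {n} → (Fin n → ℕ) → ℕ
⨆ {zero} f = 0
⨆ {suc n} f = f Fin.zero ⊔ ⨆ (f ∘ Fin.suc)

≤-⨆ : ∀ {n} (f : Fin n → ℕ) j → f j ≤ ⨆ f
≤-⨆ f Fin.zero = ℕ.m≤m⊔n _ _
≤-⨆ f (Fin.suc j) = ℕ.≤-trans (≤-⨆ (f ∘ Fin.suc) j) (ℕ.m≤n⊔m _ _)

width : FPT → ℕ
width (node n _ ts) = n ⊔ ⨆ (λ j → width (ts j))

height : FPT → ℕ
height (node _ _ ts) = suc (⨆ (λ j → height (ts j)))

fits : ∀ t → Fits (width t) (height t) t
fits (node n _ ts) = ℕ.m≤m⊔n _ _ , λ j →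
  Fits-mono (ts j) (ℕ.≤-trans (≤-⨆ (λ j → width (ts j)) j) (ℕ.m≤n⊔m n _))
                   (≤-⨆ (λ j → height (ts j)) j) (fits (ts j))

Differ : ℕ → ℕ → (Word → Word) → (Word → Word) → Set
Differ K D f g = ∃ λ w → Admissible K D w × f w ≢ g w

Separated : ℕ → ℕ → FPT → FPT → Set
Separated K D u v = Differ K D (act u) (act v) × Differ K D (act⁻¹ u) (act⁻¹ v)

padding-admissible : ∀ {K} D → 0 < K → Admissible K D (replicate D (0 , false))
padding-admissible zero _ = _
padding-admissible (suc D) 0<K = 0<K , padding-admissible D 0<K

<?-self≢ : ∀ {n m} → n < m → does (n <? n) ≢ does (n <? m)
<?-self≢ {n} {m} n<m rewrite dec-false (n <? n) (ℕ.n≮n n) | dec-true (n <? m) n<m = λ ()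

module _ {K D : ℕ} where

  probe : ℕ → Word
  probe i = (i , false) ∷ replicate D (0 , false)

  probe-admissible : ∀ {i} → i < K → Admissible K (suc D) (probe i)
  probe-admissible i<K = i<K , padding-admissible D (ℕ.≤-<-trans z≤n i<K)

  separated-by-inside : ∀ {u v i} → i < K → inside u i ≢ inside v i → Separated K (suc D) u v
  separated-by-inside {i = i} i<K ne =
    (probe i , probe-admissible i<K , ne ∘ flag) , (probe i , probe-admissible i<K , ne ∘ flag)
    where
    flag : ∀ {x y : ℕ × Bool} {xs ys} → x ∷ xs ≡ y ∷ ys → proj₂ x ≡ proj₂ y
    flag = cong proj₂ ∘ ∷-injectiveˡ

  separated-by-arity : ∀ {u v} → arity u ≤ K → arity v ≤ K → arity u ≢ arity v →
                       Separated K (suc D) u v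
  separated-by-arity {u} {v} n≤K m≤K n≢m with ℕ.<-cmp (arity u) (arity v)
  ... | tri< n<m _ _ = separated-by-inside (ℕ.<-≤-trans n<m m≤K) (<?-self≢ n<m)
  ... | tri≈ _ n≡m _ = contradiction n≡m n≢m
  ... | tri> _ _ m<n = separated-by-inside (ℕ.<-≤-trans m<n n≤K) (≢-sym (<?-self≢ m<n))

  separated-by-label : ∀ {u v i} → arity u ≤ K → i < K → label u i ≢ label v i →
                       Separated K (suc D) u v
  separated-by-label {u} {v} {i} u≤K i<K ui≢vi =
    (probe i , probe-admissible i<K , λ e → ui≢vi (letter₁ e)) ,
    (probe (label u i) , probe-admissible (label-<-mono u u≤K i<K) , λ e → ui≢vi (begin
      label u i                                 ≡⟨ label-label⁻¹ v (label u i) ⟨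
      label v (label⁻¹ v (label u i))           ≡⟨ cong (label v) (letter₁ e) ⟨
      label v (label⁻¹ u (label u i))           ≡⟨ cong (label v) (label⁻¹-label u i) ⟩
      label v i                                 ∎))
    where
    letter₁ : ∀ {x y : ℕ × Bool} {xs ys} → x ∷ xs ≡ y ∷ ys → proj₁ x ≡ proj₁ y
    letter₁ = cong proj₁ ∘ ∷-injectiveˡ

  separated-by-child : ∀ {u v i} → arity u ≤ K → i < K → label u i ≡ label v i →
                       Separated K D (child u i) (child v i) → Separated K (suc D) u v
  separated-by-child {u} {v} {i} u≤K i<K ui≡vi ((w , aw , uw≢vw) , (w⁻ , aw⁻ , uw⁻≢vw⁻)) =
    ((i , false) ∷ w⁻ , (i<K , aw⁻) , uw⁻≢vw⁻ ∘ ∷-injectiveʳ) ,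
    ((label u i , false) ∷ w , (label-<-mono u u≤K i<K , aw) , λ e → uw≢vw (begin
      act (child u i) w                            ≡⟨ cong (λ k → act (child u k) w) (label⁻¹-label u i) ⟨
      act (child u (label⁻¹ u (label u i))) w      ≡⟨ ∷-injectiveʳ e ⟩
      act (child v (label⁻¹ v (label u i))) w      ≡⟨ cong (λ k → act (child v (label⁻¹ v k)) w) ui≡vi ⟩
      act (child v (label⁻¹ v (label v i))) w      ≡⟨ cong (λ k → act (child v k) w) (label⁻¹-label v i) ⟩
      act (child v i) w                            ∎))

separate : ∀ {K D u v} → Fits K D u → Fits K D v → ¬ u ≈T v → Separated K D u v
separate {D = suc D} {node n π ts} {node m ρ us} (n≤K , fts) (m≤K , fus) u≉v with n ≟ m
... | no n≢m = separated-by-arity n≤K m≤K n≢m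
... | yes refl with Finₚ.all? (λ j → π ⟨$⟩ʳ j Finₚ.≟ ρ ⟨$⟩ʳ j)
...   | no π≉ρ = let j , πj≢ρj = Finₚ.¬∀⟶∃¬ n _ (λ j → π ⟨$⟩ʳ j Finₚ.≟ ρ ⟨$⟩ʳ j) π≉ρ in
  separated-by-label n≤K (ℕ.<-≤-trans (Finₚ.toℕ<n j) n≤K) λ e →
    πj≢ρj (Finₚ.toℕ-injective (trans (sym (⟨$⟩ℕ-toℕ π j)) (trans e (⟨$⟩ℕ-toℕ ρ j))))
...   | yes π≗ρ = let j , tj≉uj = Finₚ.¬∀⟶∃¬ n _ (λ j → ts j ≈T? us j) (u≉v ∘ node≈ π≗ρ) in
  separated-by-child n≤K (ℕ.<-≤-trans (Finₚ.toℕ<n j) n≤K)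
    (trans (⟨$⟩ℕ-toℕ π j) (trans (cong toℕ (π≗ρ j)) (sym (⟨$⟩ℕ-toℕ ρ j))))
    (subst₂ (Separated _ D) (sym (child-toℕ {π = π} j)) (sym (child-toℕ {π = ρ} j))
      (separate (fts j) (fus j) tj≉uj))

theorem3p18 : (u v : FPT) → ¬ (u ≈T v) →
    Σ (Monoid 0ℓ 0ℓ) λ N → IsFiniteMonoid N ×
      Σ (FPT → Monoid.Carrier N) λ α → IsFPTMonoidHom N α ×
        ¬ (Monoid._≈_ N (α u) (α v))
theorem3p18 u v u≉v =
  transformations⁰ M , transformations⁰-finite M , represent , represent-isHom , represent-separates
  where
  K = width u ⊔ width v
  D = height u ⊔ height v
  open Representation K D
  fits-u : Fits K D u
  fits-u = Fits-mono u (ℕ.m≤m⊔n _ _) (ℕ.m≤m⊔n _ _) (fits u)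
  fits-v : Fits K D v
  fits-v = Fits-mono v (ℕ.m≤n⊔m _ _) (ℕ.m≤n⊔m _ _) (fits v)
  represent-separates : ¬ Pointwise _≗_ (represent u) (represent v)
  represent-separates ρu≈ρv with separate fits-u fits-v u≉v
  ... | (w , aw , uw≢vw) , _ =
    uw≢vw (represent-≈⇒act-≡ (Fits⇒Bounded u fits-u) (Fits⇒Bounded v fits-v) ρu≈ρv w aw)
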